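{- Let $G$ be a graph, $S\subseteq V(G)$, and let $(\mathcal{S},\mathcal{T})$ be an $S$-connecting system in $G$ with $\mathcal{S}=\{S_1,\dots,S_m\}$. Let $H\subseteq G$ be a subgraph of $G$ such that for all $i\in[m]$ the set $S_i$ is self-reachable in $H$. Then $S$ is self-reachable in $H'=H\cup\mathcal{T}[S]$.
   Context: An $S$-connecting system in $G$ is a pair $(\mathcal{S},\mathcal{T})$ where $\mathcal{S}=\{S_1,\dots,S_m\}$ is a collection of subsets of $S$ and $\mathcal{T}$ is a tree such that: (1) $V(\mathcal{T})=S\cup\{u_1,\dots,u_m\}$ with $m=|\mathcal{S}|$; (2) for all $i\in[m]$, $S_i=N_{\mathcal{T}}(u_i)\subseteq S$ and $\deg_{\mathcal{T}}(u_i)>1$; (3) for all distinct $s,s'\in S$, if $\{s,s'\}\in E(\mathcal{T})$ then $\{s,s'\}\in E(G)$. $\mathcal{T}[S]$ denotes the subgraph of $\mathcal{T}$ induced by $S$ (a subgraph of $G$ by (3)). A set $X$ is self-reachable in a graph $H$ if $X$ is contained in a single connected component of $H$, i.e., every pair of vertices of $X$ is joined by a path in $H$. -}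

module Defs where

open import Data.Nat using (ℕ; _≤_)
open import Data.Fin using (Fin)
open import Data.Sum using (_⊎_; inj₁; inj₂)
open import Data.Product using (Σ; _×_; _,_; ∃; ∃-syntax)
open import Data.Empty using (⊥)
open import Data.List using (List; []; _∷_; _++_; [_]; length)
open import Data.List.Relation.Unary.Linked using (Linked)
open import Data.List.Relation.Unary.Unique.Propositional using (Unique)
open import Relation.Nullary using (¬_)
open import Relation.Binary.PropositionalEquality using (_≡_)
open import Function.Bundles using (_⇔_)

record SimpleGraph (W : Set) : Set₁ where
  field
    Adj    : W → W → Set
    sym    : ∀ {x y} → Adj x y → Adj y x
    irrefl : ∀ {x} → ¬ Adj x x
open SimpleGraph public

record Subgraph {W : Set} (G : SimpleGraph W) : Set₁ where
  field
    Vtx   : W → Set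
    E     : W → W → Set
    E⊆G   : ∀ {x y} → E x y → Adj G x y
    E-sym : ∀ {x y} → E x y → E y x
    E-end : ∀ {x y} → E x y → Vtx x × Vtx y
open Subgraph public

data Walk {W : Set} (V : W → Set) (A : W → W → Set) : W → W → Set where
  stop : ∀ {x} → V x → Walk V A x x
  step : ∀ {x y z} → V x → A x y → Walk V A y z → Walk V A x z

SelfReachable : {W : Set} (V : W → Set) (A : W → W → Set) (X : W → Set) → Set
SelfReachable V A X =
  (∀ x → X x → V x) × (∀ x y → X x → X y → Walk V A x y)

Connected : {W : Set} (V : W → Set) (A : W → W → Set) → Set
Connected V A = ∀ x y → V x → V y → Walk V A x y

HasCycle : {W : Set} (A : W → W → Set) → Set
HasCycle {W} A = Σ W λ x → Σ W λ y → Σ W λ z → Σ (List W) λ rest →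
  Unique (x ∷ y ∷ z ∷ rest) × Linked A ((x ∷ y ∷ z ∷ rest) ++ [ x ])

record IsTree {W : Set} (V : W → Set) (A : W → W → Set) : Set where
  field
    sym       : ∀ {x y} → A x y → A y x
    irrefl    : ∀ {x} → ¬ A x x
    edges-in  : ∀ {x y} → A x y → V x × V y
    connected : Connected V A
    acyclic   : ¬ HasCycle A

-- S-connecting systems in G (vertices of G : Fin n).  The tree 𝒯 has
-- vertex type Fin n ⊎ Fin m: inj₁ s stands for s ∈ S, inj₂ i for the
-- new vertex u_i.  Its vertex set is S ∪ {u_1,…,u_m}.

TVtx : ∀ {n m} → (Fin n → Set) → Fin n ⊎ Fin m → Set
TVtx S (inj₁ s) = S s
TVtx S (inj₂ i) = Fin 1

record ConnectingSystem {n : ℕ} (G : SimpleGraph (Fin n)) (S : Fin n → Set)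
                        (m : ℕ) (𝒮 : Fin m → Fin n → Set) : Set₁ where
  field
    TAdj   : Fin n ⊎ Fin m → Fin n ⊎ Fin m → Set
    isTree : IsTree (TVtx S) TAdj
    Si=N   : ∀ i v → (TAdj (inj₂ i) v ⇔ (Σ (Fin n) λ s → (v ≡ inj₁ s) × 𝒮 i s))
    Si⊆S   : ∀ i s → 𝒮 i s → S s
    deg>1  : ∀ i → Σ (Fin n ⊎ Fin m) λ v → Σ (Fin n ⊎ Fin m) λ w →
               ¬ (v ≡ w) × TAdj (inj₂ i) v × TAdj (inj₂ i) w
    TS⊆G   : ∀ s s' → TAdj (inj₁ s) (inj₁ s') → Adj G s s'
open ConnectingSystem public

UnionV : ∀ {n} {G : SimpleGraph (Fin n)} → Subgraph G → (Fin n → Set) → Fin n → Set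
UnionV H S x = Vtx H x ⊎ S x

UnionE : ∀ {n m} {G : SimpleGraph (Fin n)} {S : Fin n → Set} {𝒮 : Fin m → Fin n → Set} →
         Subgraph G → ConnectingSystem G S m 𝒮 → Fin n → Fin n → Set
UnionE H C x y = E H x y ⊎ TAdj C (inj₁ x) (inj₁ y)

{-# OPTIONS --safe #-}
module Submission where

-- Any two vertices of S are joined by a path of the tree 𝒯.  Its S–S steps
-- are edges of 𝒯[S]; every other step is a detour s – u_i – s' with s, s' ∈ S_i,
-- which self-reachability of S_i in H replaces by a walk in H.

open import Defs
open import Data.Nat using (ℕ)
open import Data.Fin using (Fin)
open import Data.Sum using (_⊎_; inj₁; inj₂)
open import Data.Product using (_,_; proj₂)
open import Data.Empty using (⊥-elim)
open import Relation.Nullary using (¬_)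
open import Relation.Binary.PropositionalEquality using (refl)
open import Function.Bundles using (Equivalence)

module _ {W : Set} {V : W → Set} {A : W → W → Set} where

  _++ʷ_ : ∀ {x y z} → Walk V A x y → Walk V A y z → Walk V A x z
  stop _     ++ʷ q = q
  step v a p ++ʷ q = step v a (p ++ʷ q)

mapʷ : ∀ {W : Set} {V V′ : W → Set} {A A′ : W → W → Set} →
       (∀ {x} → V x → V′ x) → (∀ {x y} → A x y → A′ x y) →
       ∀ {x y} → Walk V A x y → Walk V′ A′ x y
mapʷ f g (stop v)     = stop (f v)
mapʷ f g (step v a p) = step (f v) (g a) (mapʷ f g p)

module _ {W I : Set} {V : W ⊎ I → Set} {A : W ⊎ I → W ⊎ I → Set}
         {V′ : W → Set} {A′ : W → W → Set}
         (vertex    : ∀ {x} → V (inj₁ x) → V′ x)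
         (edge      : ∀ {x y} → A (inj₁ x) (inj₁ y) → A′ x y)
         (hubs-¬adj : ∀ {i j} → ¬ A (inj₂ i) (inj₂ j))
         (detour    : ∀ {i x y} → A (inj₁ x) (inj₂ i) → A (inj₂ i) (inj₁ y) →
                      Walk V′ A′ x y) where

  contract-hubs : ∀ {x y} → Walk V A (inj₁ x) (inj₁ y) → Walk V′ A′ x y
  contract-hubs (stop v) = stop (vertex v)
  contract-hubs (step {y = inj₁ _} v a p) = step (vertex v) (edge a) (contract-hubs p)
  contract-hubs (step {y = inj₂ _} _ a (step {y = inj₁ _} _ a′ p)) =
    detour a a′ ++ʷ contract-hubs p
  contract-hubs (step {y = inj₂ _} _ _ (step {y = inj₂ _} _ a′ _)) =
    ⊥-elim (hubs-¬adj a′)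

module _ {n m : ℕ} {G : SimpleGraph (Fin n)} {S : Fin n → Set}
         {𝒮 : Fin m → Fin n → Set} (C : ConnectingSystem G S m 𝒮) where

  hub-neighbour∈𝒮 : ∀ {i s} → TAdj C (inj₂ i) (inj₁ s) → 𝒮 i s
  hub-neighbour∈𝒮 {i} {s} a with Equivalence.to (Si=N C i (inj₁ s)) a
  ... | _ , refl , s∈𝒮ᵢ = s∈𝒮ᵢ

  hubs-¬adj : ∀ {i j} → ¬ TAdj C (inj₂ i) (inj₂ j)
  hubs-¬adj {i} {j} a with Equivalence.to (Si=N C i (inj₂ j)) a
  ... | _ , () , _

lemma5 : ∀ {n : ℕ} (G : SimpleGraph (Fin n)) (S : Fin n → Set)
           (m : ℕ) (𝒮 : Fin m → Fin n → Set) (C : ConnectingSystem G S m 𝒮)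
           (H : Subgraph G) →
           (∀ i → SelfReachable (Vtx H) (E H) (𝒮 i)) →
           SelfReachable (UnionV H S) (UnionE H C) S
lemma5 G S m 𝒮 C H 𝒮ᵢ-reachable = (λ _ → inj₂) , walk
  where
  open IsTree (isTree C) using (connected) renaming (sym to 𝒯-sym)

  detour : ∀ {i x y} → TAdj C (inj₁ x) (inj₂ i) → TAdj C (inj₂ i) (inj₁ y) →
           Walk (UnionV H S) (UnionE H C) x y
  detour {i} {x} {y} a a′ =
    mapʷ inj₁ inj₁ (proj₂ (𝒮ᵢ-reachable i) x y
                      (hub-neighbour∈𝒮 C (𝒯-sym a)) (hub-neighbour∈𝒮 C a′))

  walk : ∀ x y → S x → S y → Walk (UnionV H S) (UnionE H C) x y
  walk x y x∈S y∈S =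
    contract-hubs inj₂ inj₂ (hubs-¬adj C) detour (connected (inj₁ x) (inj₁ y) x∈S y∈S)
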